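{- Let $\ell\ge4$ be an integer, $f$ a slow function and $G$ the $(f,\ell)$-layered wheel with layers $L_1,L_2,\dots$. If $P=p_ip_{i+1}p_{i+2}\dots$ is a vertical path, then for all $j\ge i$, $N^\uparrow[p_j]\subseteq V(P)\cup N^\uparrow(p_i)$.
   Context: A vertical path starting in layer $i$ is an infinite sequence $P=p_ip_{i+1}p_{i+2}\dots$ with $p_j\in L_j$ and $p_jp_{j+1}$ an edge of $G$ for all $j\ge i$ (not necessarily induced). A function $f:\mathbb N\setminus\{0\}\to\mathbb N\setminus\{0\}$ is slow if $f(1)=1,f(2)=2,f(3)=3$ and $f(i)\le f(i+1)\le f(i)+1$ for all $i$. The $(f,\ell)$-layered wheel $G$ is the infinite graph (considered as an undirected simple graph; orientations only descriptive) whose vertex set is partitioned into finite layers $L_1,L_2,\dots$, built inductively. For $v\in L_i$ let $N^\uparrow(v)$ be the set of neighbours of $v$ in $L_1\cup\dots\cup L_{i-1}$ and $N^\uparrow[v]=N^\uparrow(v)\cup\{v\}$. $L_1$ induces a directed cycle of length $\ell$. Given $L_1,\dots,L_i$, for each $v\in L_i$ create a directed path $L(v)=v_1\dots v_{n_v}$ of new vertices: (a) if $|N^\uparrow(v)|<f(i+1)-1$, then $n_v=\ell-2$, $N^\uparrow(v_1)=N^\uparrow[v]$ and $N^\uparrow(v_j)=\emptyset$ for $j\ge2$; (b) if $|N^\uparrow(v)|=f(i+1)-1=:m$, write $N^\uparrow(v)=\{w_1,\dots,w_m\}$; then $n_v=m(\ell-2)$, $N^\uparrow(v_{(j-1)(\ell-2)+1})=N^\uparrow[v]\setminus\{w_j\}$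 for $j=1,\dots,m$, and all other vertices of $L(v)$ have $N^\uparrow=\emptyset$ (the construction guarantees $|N^\uparrow(v)|\le f(i+1)-1$ always). Specifying $N^\uparrow(u)$ for a new vertex $u$ means $u$ is adjacent exactly to those vertices of earlier layers. $L_{i+1}=\bigcup_{v\in L_i}V(L(v))$ induces the directed cycle obtained from the paths $L(v)$ by adding, for every arc $vv'$ of the cycle $L_i$, the arc $v_{n_v}v'_1$. -}

module Defs where

open import Data.Nat using (ℕ; zero; suc; _∸_; _≤_; _<_; _<?_)
import Data.Nat.Properties as ℕP
open import Data.Product using (_×_; _,_; ∃)
open import Data.Product.Properties using (≡-dec)
open import Data.Sum using (_⊎_)
open import Data.List using (List; []; _∷_; _++_; [_]; replicate; length; concat; concatMap; filter)
open import Data.List.Membership.Propositional using (_∈_)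
open import Relation.Nullary using (yes; no; ¬?)
open import Relation.Binary.Definitions using (DecidableEquality)
open import Relation.Binary.PropositionalEquality using (_≡_)

-- A vertex is named by (layer number i ≥ 1, position k in the cyclic order of layer i,
-- counted from 0 along the orientation of the directed cycle L_i).
Vtx : Set
Vtx = ℕ × ℕ

_≟V_ : DecidableEquality Vtx
_≟V_ = ≡-dec ℕP._≟_ ℕP._≟_

-- f : ℕ∖{0} → ℕ∖{0} is represented by a function ℕ → ℕ whose value at 0 is irrelevant.
Slow : (ℕ → ℕ) → Set
Slow f = f 1 ≡ 1 × f 2 ≡ 2 × f 3 ≡ 3
       × (∀ i → 1 ≤ i → f i ≤ f (suc i) × f (suc i) ≤ suc (f i))

-- The enumeration w_1,…,w_m of N↑(v) chosen in case (b) of the construction,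
-- for the vertex v = (i , k) whose up-neighbourhood is the given list.
Ordering : Set
Ordering = ℕ → ℕ → List Vtx → List Vtx

removeV : Vtx → List Vtx → List Vtx
removeV w = filter (λ x → ¬? (x ≟V w))

lookupD : List (List Vtx) → ℕ → List Vtx
lookupD []       _       = []
lookupD (x ∷ xs) zero    = x
lookupD (x ∷ xs) (suc k) = lookupD xs k

module Wheel (ℓ : ℕ) (f : ℕ → ℕ) (ord : Ordering) where

  -- a path of ℓ-2 new vertices, the first with up-neighbourhood `up`, the others with none
  block : List Vtx → List (List Vtx)
  block up = up ∷ replicate (ℓ ∸ 3) []

  -- the up-neighbourhoods of the vertices of the path L(v), v = (i , k) ∈ L_i with N↑(v) = U
  children : ℕ → ℕ → List Vtx → List (List Vtx)
  children i k U with length U <? f (suc i) ∸ 1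
  ... | yes _ = block (U ++ [ (i , k) ])
  ... | no  _ = concatMap (λ w → block (removeV w (U ++ [ (i , k) ]))) (ord i k U)

  stepFrom : ℕ → ℕ → List (List Vtx) → List (List Vtx)
  stepFrom i k []       = []
  stepFrom i k (U ∷ Us) = children i k U ++ stepFrom i (suc k) Us

  -- layer i, as the list (in cyclic order) of the up-neighbourhoods N↑ of its vertices
  layer : ℕ → List (List Vtx)
  layer zero                = []
  layer (suc zero)          = replicate ℓ []
  layer (suc (suc n))       = stepFrom (suc n) 0 (layer (suc n))

  size : ℕ → ℕ
  size i = length (layer i)

  InG : Vtx → Set
  InG (i , k) = 1 ≤ i × k < size i

  up : Vtx → List Vtx
  up (i , k) = lookupD (layer i) k

  upC : Vtx → List Vtx
  upC v = v ∷ up v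

  CycleArc : Vtx → Vtx → Set
  CycleArc (i , k) (i' , k') = i ≡ i' × (k' ≡ suc k ⊎ (k' ≡ 0 × suc k ≡ size i))

  Adj : Vtx → Vtx → Set
  Adj x y = InG x × InG y × (CycleArc x y ⊎ CycleArc y x ⊎ y ∈ up x ⊎ x ∈ up y)

  -- p_j = (j , p j) for j ≥ i
  IsVerticalPath : ℕ → (ℕ → ℕ) → Set
  IsVerticalPath i p = ∀ j → i ≤ j → InG (j , p j) × Adj (j , p j) (suc j , p (suc j))

  OnPath : ℕ → (ℕ → ℕ) → Vtx → Set
  OnPath i p x = ∃ λ j → i ≤ j × x ≡ (j , p j)

-- Every vertex u of layer n + 1 was created on the path L(v) of some v ∈ L_n and
-- inherited N↑(u) ⊆ N↑[v]; since up-neighbours lie in strictly earlier layers, v is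
-- the only vertex of L_n in N↑(u).  On a vertical path p_j p_{j+1} is an edge
-- between consecutive layers, so p_j is that parent and N↑[p_{j+1}] ⊆ {p_{j+1}} ∪ N↑[p_j];
-- the claim follows by induction on j.  Neither ℓ ≥ 4, slowness of f nor the
-- enumeration of N↑(v) plays any role.
module Submission where

open import Defs
open import Data.Nat using (ℕ; _≤_)
open import Data.Sum using (_⊎_)
open import Data.Product using (_,_)
open import Data.List using (List)
open import Data.List.Membership.Propositional using (_∈_)
open import Data.List.Relation.Binary.Permutation.Propositional using (_↭_)

open import Data.Nat using (zero; suc; _+_; _<_; _<?_; _∸_; _≤′_; ≤′-refl; ≤′-step)
open import Data.Nat.Properties using (+-suc; +-identityʳ; <-irrefl; n<1+n; <-trans; <-asym; ≤⇒≤′; ≤′⇒≤; ≤-refl)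
open import Data.Product using (∃; proj₁; proj₂)
open import Data.Sum using (inj₁; inj₂)
open import Data.Empty using (⊥-elim)
open import Data.List using ([]; _∷_; _++_; [_]; replicate; length)
open import Data.List.Relation.Unary.Any using (here; there)
open import Data.List.Relation.Unary.All as All using (All; []; _∷_)
import Data.List.Relation.Unary.All.Properties as All
open import Data.List.Relation.Binary.Subset.Propositional using (_⊆_)
open import Data.List.Relation.Binary.Subset.Propositional.Properties
  using (⊆-refl; ⊆-trans; ⊆-reflexive-↭; filter-⊆)
open import Data.List.Relation.Binary.Permutation.Propositional using (↭-sym)
open import Data.List.Relation.Binary.Permutation.Propositional.Properties using (∷↭∷ʳ)
open import Relation.Nullary using (yes; no)
open import Relation.Binary.PropositionalEquality using (_≡_; refl; sym; subst)

All-lookupD : ∀ {P : List Vtx → Set} {xs} → All P xs → P [] → ∀ t → P (lookupD xs t)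
All-lookupD []         p[] t       = p[]
All-lookupD (px ∷ _)   p[] zero    = px
All-lookupD (_ ∷ pxs)  p[] (suc t) = All-lookupD pxs p[] t

lookupD-replicate-[] : ∀ n t → lookupD (replicate n []) t ≡ []
lookupD-replicate-[] zero    t       = refl
lookupD-replicate-[] (suc n) zero    = refl
lookupD-replicate-[] (suc n) (suc t) = lookupD-replicate-[] n t

∷ʳ-⊆-∷ : ∀ (v : Vtx) U → U ++ [ v ] ⊆ v ∷ U
∷ʳ-⊆-∷ v U = ⊆-reflexive-↭ (↭-sym (∷↭∷ʳ v U))

removeV-⊆ : ∀ w S → removeV w S ⊆ S
removeV-⊆ w = filter-⊆ _

module _ (ℓ : ℕ) (f : ℕ → ℕ) (ord : Ordering) where
  open Wheel ℓ f ord

  block-⊆ : ∀ {S V} → V ⊆ S → All (_⊆ S) (block V)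
  block-⊆ V⊆S = V⊆S ∷ All.replicate⁺ (ℓ ∸ 3) (λ ())

  children-⊆ : ∀ i k U → All (_⊆ U ++ [ (i , k) ]) (children i k U)
  children-⊆ i k U with length U <? f (suc i) ∸ 1
  ... | yes _ = block-⊆ ⊆-refl
  ... | no  _ = All.concat⁺ (All.map⁺ {xs = ord i k U} (All.tabulate λ {w} _ → block-⊆ (removeV-⊆ w _)))

  Descends : ℕ → ℕ → List (List Vtx) → List Vtx → Set
  Descends i k Us V = ∃ λ m → V ⊆ (i , k + m) ∷ lookupD Us m

  stepFrom-descends : ∀ i k Us → All (Descends i k Us) (stepFrom i k Us)
  stepFrom-descends i k []       = []
  stepFrom-descends i k (U ∷ Us) =
    All.++⁺ (All.map fromHead (children-⊆ i k U))
            (All.map fromTail (stepFrom-descends i (suc k) Us))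
    where
    fromHead : ∀ {V} → V ⊆ U ++ [ (i , k) ] → Descends i k (U ∷ Us) V
    fromHead {V} V⊆ = 0 , subst (λ t → V ⊆ (i , t) ∷ U) (sym (+-identityʳ k)) (⊆-trans V⊆ (∷ʳ-⊆-∷ (i , k) U))

    fromTail : ∀ {V} → Descends i (suc k) Us V → Descends i k (U ∷ Us) V
    fromTail {V} (m , V⊆) = suc m , subst (λ t → V ⊆ (i , t) ∷ lookupD Us m) (sym (+-suc k m)) V⊆

  parent : ∀ n k → ∃ λ m → up (suc n , k) ⊆ upC (n , m)
  parent zero    k rewrite lookupD-replicate-[] ℓ k = 0 , λ ()
  parent (suc n) k = All-lookupD (stepFrom-descends (suc n) 0 (layer (suc n))) (0 , λ ()) k

  up-earlier : ∀ n k {y} → y ∈ up (n , k) → proj₁ y < n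
  up-earlier zero    k ()
  up-earlier (suc n) k y∈ with parent n k
  ... | m , up⊆ with up⊆ y∈
  ... | here refl = n<1+n n
  ... | there y∈′ = <-trans (up-earlier n m y∈′) (n<1+n n)

  adjacent-next-layer⇒∈up : ∀ {j a b} → Adj (j , a) (suc j , b) → (j , a) ∈ up (suc j , b)
  adjacent-next-layer⇒∈up {j} (_ , _ , inj₁ (j≡1+j , _))                 = ⊥-elim (<-irrefl j≡1+j (n<1+n j))
  adjacent-next-layer⇒∈up {j} (_ , _ , inj₂ (inj₁ (1+j≡j , _)))          = ⊥-elim (<-irrefl (sym 1+j≡j) (n<1+n j))
  adjacent-next-layer⇒∈up {j} (_ , _ , inj₂ (inj₂ (inj₁ upper∈up)))      = ⊥-elim (<-asym (up-earlier j _ upper∈up) (n<1+n j))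
  adjacent-next-layer⇒∈up     (_ , _ , inj₂ (inj₂ (inj₂ lower∈up)))      = lower∈up

  ∈up⇒up⊆upC : ∀ {j a b} → (j , a) ∈ up (suc j , b) → up (suc j , b) ⊆ upC (j , a)
  ∈up⇒up⊆upC {j} {a} {b} a∈ with parent j b
  ... | m , up⊆ with up⊆ a∈
  ... | here refl = up⊆
  ... | there a∈′ = ⊥-elim (<-irrefl refl (up-earlier j m a∈′))

  vertical-path-upC : ∀ i p → IsVerticalPath i p → ∀ {j} → i ≤′ j → ∀ {x} → x ∈ upC (j , p j)
                    → OnPath i p x ⊎ x ∈ up (i , p i)
  vertical-path-upC i p vp ≤′-refl         (here refl) = inj₁ (i , ≤-refl , refl)
  vertical-path-upC i p vp ≤′-refl         (there x∈)  = inj₂ x∈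
  vertical-path-upC i p vp (≤′-step i≤′j)  (here refl) = inj₁ (_ , ≤′⇒≤ (≤′-step i≤′j) , refl)
  vertical-path-upC i p vp {suc j} (≤′-step i≤′j) (there x∈) =
    vertical-path-upC i p vp i≤′j (∈up⇒up⊆upC (adjacent-next-layer⇒∈up edge) x∈)
    where
    edge : Adj (j , p j) (suc j , p (suc j))
    edge = proj₂ (vp j (≤′⇒≤ i≤′j))

mainTheorem9 : (ℓ : ℕ) → 4 ≤ ℓ → (f : ℕ → ℕ) → Slow f
    → (ord : Ordering) → (∀ i k (U : List Vtx) → ord i k U ↭ U)
    → let open Wheel ℓ f ord in
    (i : ℕ) → 1 ≤ i → (p : ℕ → ℕ) → IsVerticalPath i p
    → ∀ j → i ≤ j → ∀ x → x ∈ upC (j , p j)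
    → OnPath i p x ⊎ x ∈ up (i , p i)
mainTheorem9 ℓ _ f _ ord _ i _ p vp j i≤j x x∈ = vertical-path-upC ℓ f ord i p vp (≤⇒≤′ i≤j) x∈
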